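{- Let $\Gamma$ be a numerical monoid with minimal generators $g_0<g_1<\cdots<g_e$. Let $C\subseteq\{g_1,\dots,g_e\}$ be a subset and $t=|C|$. If $\mathrm{Ap}(\Gamma)=\{0,g_1,\dots,g_e\}\cup(C+C)$ and $g_0=e+1+\binom{t+1}{2}$, then $g_0>t(t+1)$.
   Context: A numerical monoid is an additive submonoid $\Gamma\subseteq\mathbb{N}$ (containing $0$) with $\mathbb{N}\setminus\Gamma$ finite; it has a unique minimal set of generators $g_0<g_1<\cdots<g_e$. The Apéry set of $\Gamma$ (with respect to $g_0$) is $\mathrm{Ap}(\Gamma)=\{g\in\Gamma: g-g_0\notin\Gamma\}$. For a set $C$ of integers, $C+C=\{c+c': c,c'\in C\}$. -}

module Defs where

open import Data.Nat using (ℕ; zero; suc; _+_; _*_; _∸_; _≤_; _<_)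
open import Data.Fin using (Fin; zero; suc)
open import Data.Fin.Subset using (Subset; _∈_)
open import Data.Product using (Σ; ∃; _×_; _,_)
open import Data.Sum using (_⊎_)
open import Data.Empty using (⊥)
open import Relation.Nullary using (¬_)
open import Relation.Binary.PropositionalEquality using (_≡_)
open import Data.Vec.Functional using (foldr)
open import Function.Bundles using (_⇔_)

lincomb : ∀ {n} → (Fin n → ℕ) → (Fin n → ℕ) → ℕ
lincomb {n} c g = foldr _+_ 0 (λ i → c i * g i)

record IsNumericalMonoid (Γ : ℕ → Set) : Set where
  field
    has-zero   : Γ 0
    closed-+   : ∀ {x y} → Γ x → Γ y → Γ (x + y)
    cofinite   : ∃ λ F → ∀ n → F ≤ n → Γ n

record IsMinimalGenerators (Γ : ℕ → Set) (e : ℕ) (g : Fin (suc e) → ℕ) : Set where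
  field
    increasing : ∀ {i j : Fin (suc e)} → Data.Fin._<_ i j → g i < g j
    generates  : ∀ x → Γ x ⇔ (∃ λ (c : Fin (suc e) → ℕ) → x ≡ lincomb c g)
    minimal    : ∀ (i : Fin (suc e)) (c : Fin (suc e) → ℕ) → c i ≡ 0 → ¬ (g i ≡ lincomb c g)

-- Apéry set of Γ with respect to m: {x ∈ Γ : x - m ∉ Γ} (x - m taken in ℤ, so x < m is allowed)
Ap : (Γ : ℕ → Set) → ℕ → ℕ → Set
Ap Γ m x = Γ x × ¬ (m ≤ x × Γ (x ∸ m))

-- {0, g_1, ..., g_e} ∪ (C + C), where C = {g_i : i ∈ S}
ApShape : ∀ {e} → (g : Fin (suc e) → ℕ) → Subset (suc e) → ℕ → Set
ApShape {e} g S x =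
  x ≡ 0
  ⊎ (∃ λ (k : Fin e) → x ≡ g (suc k))
  ⊎ (∃ λ (i : Fin (suc e)) → ∃ λ (j : Fin (suc e)) → i ∈ S × j ∈ S × x ≡ g i + g j)

-- Ap Γ has one element in each residue class modulo m = g₀ and, as g₀ ≡ 0, lies modulo m in the
-- list of the e − t generators outside A = {g₀} ∪ C together with the (t+1)(t+2)/2 sums of two
-- elements of A. That list has exactly m entries, so their residues are pairwise distinct: A is a
-- Sidon set modulo m. Then the t(t+1) differences a − a′ (a ≠ a′ in A) are distinct nonzero
-- residues, whence t(t+1) ≤ m − 1.
module Submission where

open import Defs
open import Data.Nat using (ℕ; zero; suc; pred; _+_; _*_; _∸_; _≤_; _<_; _%_; NonZero; z≤n; s≤s)
open import Data.Nat.Properties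
  using (+-comm; +-assoc; +-identityʳ; *-comm; *-suc; m∸n+n≡m; m+n∸n≡m; m≤n⇒m≤o+n; m≤m*n; <⇒≱; ≤-reflexive; module ≤-Reasoning)
open import Data.Nat.DivMod using (_mod_; %-distribˡ-+; [m+n]%n≡m%n; [m+kn]%n≡m%n; m*n%n≡0; n%n≡0; m<n⇒m%n≡m)
open import Data.Nat.Combinatorics using (_C_; nC1≡n; nCk+nC[k+1]≡[n+1]C[k+1])
open import Data.Fin using (Fin; zero; suc; toℕ; punchIn; punchOut; remQuot; _≟_; _↑ˡ_; _↑ʳ_)
open import Data.Fin.Properties
  using (any?; injective⇒≤; toℕ<n; toℕ-injective; toℕ-fromℕ<; fromℕ<-cong; ↑ʳ-injective; *↔×;
         punchIn-injective; punchInᵢ≢i; punchOut-injective; punchIn-punchOut)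
open import Data.Fin.Subset using (Subset; inside; outside; _∈_; _∉_; ∣_∣; ∁; _∪_; ⁅_⁆)
open import Data.Fin.Subset.Properties
  using (_∈?_; x∉p⇒x∈∁p; ∣∁p∣≡n∸∣p∣; ∣p∣≤n; ∪-identityʳ; p⊆p∪q; q⊆p∪q; x∈⁅x⁆)
open import Data.Vec using (_∷_; here; there)
open import Data.Vec.Functional using (Vector; _++_)
open import Data.Vec.Functional.Properties using (lookup-++ˡ; lookup-++ʳ)
open import Data.Product using (∃; _×_; _,_; proj₁; proj₂; uncurry)
import Data.Product as Product
open import Data.Sum using (_⊎_; inj₁; inj₂)
open import Function using (_∘_)
open import Function.Bundles using (_⇔_; Equivalence; Injection)
open import Function.Definitions using (Injective; StrictlySurjective)
open import Function.Properties.Inverse using (↔⇒↣)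
open import Relation.Nullary using (¬_; yes; no; contradiction)
open import Relation.Nullary.Negation using (¬¬-map)
open import Relation.Nullary.Decidable using (decidable-stable)
open import Relation.Binary.PropositionalEquality

infix 4 _≈ᵘ_

data _≈ᵘ_ {A : Set} : A × A → A × A → Set where
  same : ∀ {x y} → (x , y) ≈ᵘ (x , y)
  swap : ∀ {x y} → (x , y) ≈ᵘ (y , x)

≈ᵘ-sym : ∀ {A : Set} {p q : A × A} → p ≈ᵘ q → q ≈ᵘ p
≈ᵘ-sym same = same
≈ᵘ-sym swap = swap

≈ᵘ-trans : ∀ {A : Set} {p q r : A × A} → p ≈ᵘ q → q ≈ᵘ r → p ≈ᵘ r
≈ᵘ-trans same q≈r = q≈r
≈ᵘ-trans swap same = swap
≈ᵘ-trans swap swap = same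

≈ᵘ-map : ∀ {A B : Set} (f : A → B) {p q : A × A} → p ≈ᵘ q → Product.map f f p ≈ᵘ Product.map f f q
≈ᵘ-map f same = same
≈ᵘ-map f swap = swap

≈ᵘ-sum : ∀ {A : Set} (v : A → ℕ) {x y x′ y′ : A} → (x , y) ≈ᵘ (x′ , y′) → v x + v y ≡ v x′ + v y′
≈ᵘ-sum v same = refl
≈ᵘ-sum v {x} {y} swap = +-comm (v x) (v y)

≈ᵘ-components : ∀ {A : Set} {a b c d : A} → (a , b) ≈ᵘ (c , d) → (a ≡ c × b ≡ d) ⊎ (a ≡ d × b ≡ c)
≈ᵘ-components same = inj₁ (refl , refl)
≈ᵘ-components swap = inj₂ (refl , refl)

≈ᵘ-diagonal : ∀ {A : Set} {x y : A} → (x , y) ≈ᵘ (y , y) → x ≡ y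
≈ᵘ-diagonal same = refl
≈ᵘ-diagonal swap = refl

triangle : ℕ → ℕ
triangle zero    = 0
triangle (suc n) = suc n + triangle n

triangle≡C : ∀ n → triangle n ≡ suc n C 2
triangle≡C zero    = refl
triangle≡C (suc n) = trans (cong₂ _+_ (sym (nC1≡n (suc n))) (triangle≡C n))
                           (nCk+nC[k+1]≡[n+1]C[k+1] (suc n) 1)

unorderedPairs : ∀ n → Vector (Fin n × Fin n) (triangle n)
unorderedPairs zero    ()
unorderedPairs (suc n) = (zero ,_) ++ (Product.map suc suc ∘ unorderedPairs n)

unorderedPairs-complete : ∀ n (a b : Fin n) → ∃ λ k → unorderedPairs n k ≈ᵘ (a , b)
unorderedPairs-complete (suc n) = complete
  where
  rest : Vector (Fin (suc n) × Fin (suc n)) (triangle n)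
  rest = Product.map suc suc ∘ unorderedPairs n

  complete : ∀ a b → ∃ λ k → unorderedPairs (suc n) k ≈ᵘ (a , b)
  complete zero b =
    b ↑ˡ triangle n , subst (_≈ᵘ (zero , b)) (sym (lookup-++ˡ (zero ,_) rest b)) same
  complete (suc a) zero =
    suc a ↑ˡ triangle n , subst (_≈ᵘ (suc a , zero)) (sym (lookup-++ˡ (zero ,_) rest (suc a))) swap
  complete (suc a) (suc b) with unorderedPairs-complete n a b
  ... | k , pₖ≈ab =
    suc n ↑ʳ k , subst (_≈ᵘ (suc a , suc b)) (sym (lookup-++ʳ (zero ,_) rest k)) (≈ᵘ-map suc pₖ≈ab)

elements : ∀ {n} (p : Subset n) → Fin ∣ p ∣ → Fin n
elements (inside  ∷ p) zero    = zero
elements (inside  ∷ p) (suc a) = suc (elements p a)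
elements (outside ∷ p) a       = suc (elements p a)

elements-surjective : ∀ {n} (p : Subset n) {x} → x ∈ p → ∃ λ a → elements p a ≡ x
elements-surjective (inside  ∷ p) here = zero , refl
elements-surjective (inside  ∷ p) (there x∈p) = Product.map suc (cong suc) (elements-surjective p x∈p)
elements-surjective (outside ∷ p) (there x∈p) = Product.map₂ (cong suc) (elements-surjective p x∈p)

∣p∪⁅x⁆∣≡1+∣p∣ : ∀ {n} {p : Subset n} {x} → x ∉ p → ∣ p ∪ ⁅ x ⁆ ∣ ≡ suc ∣ p ∣
∣p∪⁅x⁆∣≡1+∣p∣ {p = inside  ∷ p} {zero}  x∉p = contradiction here x∉p
∣p∪⁅x⁆∣≡1+∣p∣ {p = outside ∷ p} {zero}  _   = cong (suc ∘ ∣_∣) (∪-identityʳ p)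
∣p∪⁅x⁆∣≡1+∣p∣ {p = inside  ∷ p} {suc x} x∉p = cong suc (∣p∪⁅x⁆∣≡1+∣p∣ (x∉p ∘ there))
∣p∪⁅x⁆∣≡1+∣p∣ {p = outside ∷ p} {suc x} x∉p = ∣p∪⁅x⁆∣≡1+∣p∣ (x∉p ∘ there)

∣∁p∣+∣p∣≡n : ∀ {n} (p : Subset n) → ∣ ∁ p ∣ + ∣ p ∣ ≡ n
∣∁p∣+∣p∣≡n p = trans (cong (_+ ∣ p ∣) (∣∁p∣≡n∸∣p∣ p)) (m∸n+n≡m (∣p∣≤n p))

surjective⇒≥ : ∀ {m n} {f : Fin m → Fin n} → StrictlySurjective _≡_ f → n ≤ m
surjective⇒≥ {f = f} surj = injective⇒≤ {f = proj₁ ∘ surj} λ {y} {y′} eq →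
  trans (sym (proj₂ (surj y))) (trans (cong f eq) (proj₂ (surj y′)))

surjective⇒injective : ∀ {m n} {f : Fin m → Fin n} → m ≤ n → StrictlySurjective _≡_ f → Injective _≡_ _≡_ f
surjective⇒injective {suc m} {f = f} m≤n surj {x} {y} fx≡fy with x ≟ y
... | yes x≡y = x≡y
... | no  x≢y = contradiction (surjective⇒≥ surj-without-y) (<⇒≱ m≤n)
  where
  y≢x : y ≢ x
  y≢x = x≢y ∘ sym

  surj-without-y : StrictlySurjective _≡_ (f ∘ punchIn y)
  surj-without-y z with surj z
  ... | w , fw≡z with w ≟ y
  ...   | yes refl = punchOut y≢x , trans (cong f (punchIn-punchOut y≢x)) (trans fx≡fy fw≡z)
  ...   | no  w≢y  = punchOut (w≢y ∘ sym) , trans (cong f (punchIn-punchOut (w≢y ∘ sym))) fw≡z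

residues-injective : ∀ {n} m .{{_ : NonZero m}} (L : Vector ℕ n) → n ≤ m →
                     (∀ r → r < m → ¬ ¬ ∃ λ i → L i % m ≡ r) →
                     ∀ {i j} → L i % m ≡ L j % m → i ≡ j
residues-injective m L n≤m covered eq = surjective⇒injective n≤m surj (fromℕ<-cong _ _ eq _ _)
  where
  -- Coverage is only known up to double negation, but hitting a given residue is decidable.
  surj : StrictlySurjective _≡_ (λ i → L i mod m)
  surj r = decidable-stable (any? λ i → L i mod m ≟ r)
    (¬¬-map (Product.map₂ λ eq → toℕ-injective (trans (toℕ-fromℕ< _) eq)) (covered (toℕ r) (toℕ<n r)))

IsSidonMod : ∀ m .{{_ : NonZero m}} {n} → Vector ℕ n → Set
IsSidonMod m A = ∀ a b c d → (A a + A b) % m ≡ (A c + A d) % m → (a , b) ≈ᵘ (c , d)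

%-+-congʳ : ∀ m .{{_ : NonZero m}} {x y} z → x % m ≡ y % m → (x + z) % m ≡ (y + z) % m
%-+-congʳ m {x} {y} z eq = begin
  (x + z) % m             ≡⟨ %-distribˡ-+ x z m ⟩
  (x % m + z % m) % m     ≡⟨ cong (λ r → (r + z % m) % m) eq ⟩
  (y % m + z % m) % m     ≡⟨ %-distribˡ-+ y z m ⟨
  (y + z) % m             ∎
  where open ≡-Reasoning

module _ (m′ : ℕ) where

  infix 6 _⊖_

  -- m′ ≡ −1 modulo suc m′, so a ⊖ b is the residue of a − b.
  _⊖_ : ℕ → ℕ → Fin (suc m′)
  a ⊖ b = (a + m′ * b) mod suc m′

  ⊖-self : ∀ a → a ⊖ a ≡ zero
  ⊖-self a = toℕ-injective (begin
    toℕ (a ⊖ a)             ≡⟨ toℕ-fromℕ< _ ⟩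
    (a + m′ * a) % suc m′   ≡⟨ cong (λ x → (a + x) % suc m′) (*-comm m′ a) ⟩
    (a + a * m′) % suc m′   ≡⟨ cong (_% suc m′) (*-suc a m′) ⟨
    (a * suc m′) % suc m′   ≡⟨ m*n%n≡0 a (suc m′) ⟩
    0                       ∎)
    where open ≡-Reasoning

  ⊖-≡⇒+-≡ : ∀ a b c d → a ⊖ b ≡ c ⊖ d → (a + d) % suc m′ ≡ (c + b) % suc m′
  ⊖-≡⇒+-≡ a b c d eq = begin
    (a + d) % m                       ≡⟨ [m+kn]%n≡m%n (a + d) b m ⟨
    (a + d + b * m) % m               ≡⟨ cong (_% m) (shuffle m′ a b d) ⟩
    (a + m′ * b + (b + d)) % m        ≡⟨ %-+-congʳ m {a + m′ * b} {c + m′ * d} (b + d) residues-equal ⟩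
    (c + m′ * d + (b + d)) % m        ≡⟨ cong (_% m) (trans (shuffle m′ c d b) (cong (c + m′ * d +_) (+-comm d b)))
                                       ⟨
    (c + b + d * m) % m               ≡⟨ [m+kn]%n≡m%n (c + b) d m ⟩
    (c + b) % m                       ∎
    where
    open ≡-Reasoning
    m = suc m′
    shuffle : ∀ k x y z → x + z + y * suc k ≡ x + k * y + (y + z)
    shuffle = solve-∀ where open import Data.Nat.Tactic.RingSolver
    residues-equal : (a + m′ * b) % m ≡ (c + m′ * d) % m
    residues-equal = trans (sym (toℕ-fromℕ< _)) (trans (cong toℕ eq) (toℕ-fromℕ< _))

  sidon-bound : ∀ {n} (A : Vector ℕ n) → IsSidonMod (suc m′) A → n * pred n ≤ m′
  sidon-bound {zero}  A sidon = z≤n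
  sidon-bound {suc t} A sidon =
    injective⇒≤ {f = δ′ ∘ remQuot t} (Injection.injective (↔⇒↣ *↔×) ∘ δ′-injective)
    where
    δ : Fin (suc t) → Fin (suc t) → Fin (suc m′)
    δ x y = A x ⊖ A y

    δ-≡⇒≈ᵘ : ∀ x y u v → δ x y ≡ δ u v → (x , v) ≈ᵘ (u , y)
    δ-≡⇒≈ᵘ x y u v eq = sidon x v u y (⊖-≡⇒+-≡ (A x) (A y) (A u) (A v) eq)

    δ≢0 : ∀ x j → zero ≢ δ x (punchIn x j)
    δ≢0 x j 0≡δ = punchInᵢ≢i x j (sym (≈ᵘ-diagonal (δ-≡⇒≈ᵘ x y y y δ≡δ)))
      where
      y = punchIn x j
      δ≡δ : δ x y ≡ δ y y
      δ≡δ = trans (sym 0≡δ) (sym (⊖-self (A y)))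

    δ′ : Fin (suc t) × Fin t → Fin m′
    δ′ (x , j) = punchOut (δ≢0 x j)

    δ′-injective : Injective _≡_ _≡_ δ′
    δ′-injective {x , j} {u , l} eq
      with ≈ᵘ-components (δ-≡⇒≈ᵘ x (punchIn x j) u (punchIn u l)
                            (punchOut-injective (δ≢0 x j) (δ≢0 u l) eq))
    ... | inj₁ (refl , v≡y) = cong (x ,_) (punchIn-injective x j l (sym v≡y))
    ... | inj₂ (x≡y , _)    = contradiction (sym x≡y) (punchInᵢ≢i x j)

module _ {n} (G : Vector ℕ n) (B : Subset n) where

  pairSums : Vector ℕ (triangle ∣ B ∣)
  pairSums = uncurry (λ a b → G (elements B a) + G (elements B b)) ∘ unorderedPairs ∣ B ∣

  listing : Vector ℕ (∣ ∁ B ∣ + triangle ∣ B ∣)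
  listing = (G ∘ elements (∁ B)) ++ pairSums

  pairIndex : Fin ∣ B ∣ → Fin ∣ B ∣ → Fin (∣ ∁ B ∣ + triangle ∣ B ∣)
  pairIndex a b = ∣ ∁ B ∣ ↑ʳ proj₁ (unorderedPairs-complete ∣ B ∣ a b)

  listing-pairIndex : ∀ a b → listing (pairIndex a b) ≡ G (elements B a) + G (elements B b)
  listing-pairIndex a b = trans (lookup-++ʳ (G ∘ elements (∁ B)) pairSums k)
    (≈ᵘ-sum (G ∘ elements B) (proj₂ (unorderedPairs-complete ∣ B ∣ a b)))
    where k = proj₁ (unorderedPairs-complete ∣ B ∣ a b)

  listing-outside : ∀ {i} → i ∉ B → ∃ λ k → listing k ≡ G i
  listing-outside i∉B with elements-surjective (∁ B) (x∉p⇒x∈∁p i∉B)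
  ... | a , refl = a ↑ˡ triangle ∣ B ∣ , lookup-++ˡ (G ∘ elements (∁ B)) pairSums a

  listing-pair : ∀ {i j} → i ∈ B → j ∈ B → ∃ λ k → listing k ≡ G i + G j
  listing-pair i∈B j∈B with elements-surjective B i∈B | elements-surjective B j∈B
  ... | a , refl | b , refl = pairIndex a b , listing-pairIndex a b

  pairIndex-injective : ∀ {a b c d} → pairIndex a b ≡ pairIndex c d → (a , b) ≈ᵘ (c , d)
  pairIndex-injective {a} {b} {c} {d} eq = ≈ᵘ-trans (≈ᵘ-sym (proj₂ (complete a b)))
    (subst (_≈ᵘ (c , d)) (cong (unorderedPairs ∣ B ∣) (sym (↑ʳ-injective ∣ ∁ B ∣ _ _ eq))) (proj₂ (complete c d)))
    where complete = unorderedPairs-complete ∣ B ∣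

  covering-listing⇒sidon : ∀ m .{{_ : NonZero m}} → ∣ ∁ B ∣ + triangle ∣ B ∣ ≤ m →
                           (∀ r → r < m → ¬ ¬ ∃ λ k → listing k % m ≡ r) →
                           IsSidonMod m (G ∘ elements B)
  covering-listing⇒sidon m size covered a b c d eq =
    pairIndex-injective (residues-injective m listing size covered
      (subst₂ (λ x y → x % m ≡ y % m) (sym (listing-pairIndex a b)) (sym (listing-pairIndex c d)) eq))

module _ {Γ : ℕ → Set} m .{{_ : NonZero m}} where

  apery-misses-class⇒Γ-misses-class : ∀ {r} → r < m → (∀ y → Ap Γ m y → y % m ≢ r) →
                                      ∀ q → ¬ Γ (r + q * m)
  apery-misses-class⇒Γ-misses-class {r} r<m misses zero Γr =
    misses r (subst Γ (+-identityʳ r) Γr , λ (m≤r , _) → <⇒≱ r<m m≤r) (m<n⇒m%n≡m r<m)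
  apery-misses-class⇒Γ-misses-class {r} r<m misses (suc q) Γx =
    misses x (Γx , λ (_ , Γ[x∸m]) → apery-misses-class⇒Γ-misses-class r<m misses q (subst Γ x∸m≡ Γ[x∸m]))
      (trans ([m+kn]%n≡m%n r (suc q) m) (m<n⇒m%n≡m r<m))
    where
    x = r + suc q * m
    x∸m≡ : x ∸ m ≡ r + q * m
    x∸m≡ = trans (cong (_∸ m) (trans (cong (r +_) (+-comm m (q * m))) (sym (+-assoc r (q * m) m))))
                 (m+n∸n≡m (r + q * m) m)

  apery-meets-every-class : IsNumericalMonoid Γ → ∀ {r} → r < m → ¬ ¬ ∃ λ y → Ap Γ m y × y % m ≡ r
  apery-meets-every-class numerical {r} r<m no-y with IsNumericalMonoid.cofinite numerical
  ... | F , Γ-beyond-F = apery-misses-class⇒Γ-misses-class r<m (λ y ap y≡r → no-y (y , ap , y≡r)) F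
                           (Γ-beyond-F (r + F * m) (m≤n⇒m≤o+n r (m≤m*n F m)))

-- Adjoining 0 to S puts g₀ into A, which makes 0 and every g i with i ∈ S ∪ ⁅ 0 ⁆ pair sums modulo g₀.
module _ {e m′} (g : Vector ℕ (suc e)) (g₀≡m : g zero ≡ suc m′) (S : Subset (suc e)) where

  generator-listed : ∀ i → ∃ λ k → listing g (S ∪ ⁅ zero ⁆) k % suc m′ ≡ g i % suc m′
  generator-listed i with i ∈? S ∪ ⁅ zero ⁆
  ... | no  i∉S₀ = Product.map₂ (cong (_% suc m′)) (listing-outside g _ i∉S₀)
  ... | yes i∈S₀ =
    Product.map₂ (λ eq → trans (cong (_% suc m′) eq) g[i]+g₀≡g[i]) (listing-pair g _ i∈S₀ 0∈S₀)
    where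
    0∈S₀ : zero ∈ S ∪ ⁅ zero ⁆
    0∈S₀ = q⊆p∪q S ⁅ zero ⁆ (x∈⁅x⁆ zero)

    g[i]+g₀≡g[i] : (g i + g zero) % suc m′ ≡ g i % suc m′
    g[i]+g₀≡g[i] = trans (cong (λ x → (g i + x) % suc m′) g₀≡m) ([m+n]%n≡m%n (g i) (suc m′))

  ApShape-listed : ∀ {y} → ApShape g S y → ∃ λ k → listing g (S ∪ ⁅ zero ⁆) k % suc m′ ≡ y % suc m′
  ApShape-listed (inj₁ refl) =
    Product.map₂ (λ eq → trans eq (trans (cong (_% suc m′) g₀≡m) (n%n≡0 (suc m′)))) (generator-listed zero)
  ApShape-listed (inj₂ (inj₁ (i , refl))) = generator-listed (suc i)
  ApShape-listed (inj₂ (inj₂ (i , j , i∈S , j∈S , refl))) =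
    Product.map₂ (cong (_% suc m′)) (listing-pair g _ (p⊆p∪q ⁅ zero ⁆ i∈S) (p⊆p∪q ⁅ zero ⁆ j∈S))

apery-shape-bound : ∀ {Γ} → IsNumericalMonoid Γ → ∀ {e m′} (g : Vector ℕ (suc e)) (S : Subset (suc e)) →
                    zero ∉ S → (∀ x → Ap Γ (suc m′) x → ApShape g S x) → g zero ≡ suc m′ →
                    suc e + triangle ∣ S ∣ ≤ suc m′ → suc ∣ S ∣ * ∣ S ∣ ≤ m′
apery-shape-bound numerical {e} {m′} g S 0∉S ap⊆shape g₀≡m size =
  subst (λ n → n * pred n ≤ m′) ∣S₀∣≡1+t
    (sidon-bound m′ (g ∘ elements S₀) (covering-listing⇒sidon g S₀ (suc m′) size₀ covered))
  where
  S₀ = S ∪ ⁅ zero ⁆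
  t = ∣ S ∣

  ∣S₀∣≡1+t : ∣ S₀ ∣ ≡ suc t
  ∣S₀∣≡1+t = ∣p∪⁅x⁆∣≡1+∣p∣ 0∉S

  size₀ : ∣ ∁ S₀ ∣ + triangle ∣ S₀ ∣ ≤ suc m′
  size₀ = begin
    ∣ ∁ S₀ ∣ + triangle ∣ S₀ ∣        ≡⟨ cong (λ s → ∣ ∁ S₀ ∣ + triangle s) ∣S₀∣≡1+t ⟩
    ∣ ∁ S₀ ∣ + (suc t + triangle t)   ≡⟨ cong (λ s → ∣ ∁ S₀ ∣ + (s + triangle t)) ∣S₀∣≡1+t ⟨
    ∣ ∁ S₀ ∣ + (∣ S₀ ∣ + triangle t)  ≡⟨ +-assoc ∣ ∁ S₀ ∣ ∣ S₀ ∣ (triangle t) ⟨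
    ∣ ∁ S₀ ∣ + ∣ S₀ ∣ + triangle t    ≡⟨ cong (_+ triangle t) (∣∁p∣+∣p∣≡n S₀) ⟩
    suc e + triangle t                ≤⟨ size ⟩
    suc m′                            ∎
    where open ≤-Reasoning

  covered : ∀ r → r < suc m′ → ¬ ¬ ∃ λ k → listing g S₀ k % suc m′ ≡ r
  covered r r<m = ¬¬-map
    (λ (y , ap , y≡r) → Product.map₂ (λ eq → trans eq y≡r) (ApShape-listed g g₀≡m S (ap⊆shape y ap)))
    (apery-meets-every-class (suc m′) numerical r<m)

lemma4p5 : (Γ : ℕ → Set) → IsNumericalMonoid Γ →
           (e : ℕ) (g : Fin (suc e) → ℕ) → IsMinimalGenerators Γ e g →
           (S : Subset (suc e)) → zero ∉ S →
           (∀ x → Ap Γ (g zero) x ⇔ ApShape g S x) →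
           g zero ≡ e + 1 + (suc ∣ S ∣ C 2) →
           ∣ S ∣ * (∣ S ∣ + 1) < g zero
lemma4p5 Γ numerical e g _ S 0∉S ap⇔shape g₀≡ =
  subst (t * (t + 1) <_) (sym g₀≡m)
    (s≤s (subst (_≤ m′) t[t+1]≡ (apery-shape-bound numerical g S 0∉S ap⊆shape g₀≡m size)))
  where
  t = ∣ S ∣
  m′ = e + suc t C 2

  g₀≡m : g zero ≡ suc m′
  g₀≡m = trans g₀≡ (cong (_+ suc t C 2) (+-comm e 1))

  ap⊆shape : ∀ x → Ap Γ (suc m′) x → ApShape g S x
  ap⊆shape x = Equivalence.to (ap⇔shape x) ∘ subst (λ m → Ap Γ m x) (sym g₀≡m)

  size : suc e + triangle t ≤ suc m′
  size = ≤-reflexive (cong (suc e +_) (triangle≡C t))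

  t[t+1]≡ : suc t * t ≡ t * (t + 1)
  t[t+1]≡ = trans (*-comm (suc t) t) (cong (t *_) (+-comm 1 t))
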